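{- Let $T,S\subseteq\mathbb{Z}_{>0}$ be finite and let $x\in T\triangleleft S$. If $T_{<x}\setminus(T\triangleleft S)$ is empty, then $(T\setminus\{x\})\triangleleft S=(T\triangleleft S)\setminus\{x\}$. Otherwise, $(T\setminus\{x\})\triangleleft S=((T\triangleleft S)\setminus\{x\})\cup\{x'\}$, where $x'=\max(T_{<x}\setminus(T\triangleleft S))$.
   Context: For finite $T,S\subseteq\mathbb{Z}_{>0}$, $T\triangleleft S$ is computed by going through $s\in S$ from largest to smallest; each $s$ picks the largest not-yet-picked $t\in T$ with $t<s$, if one exists; $T\triangleleft S$ is the set of picked elements. $T_{<x}=\{t\in T:t<x\}$. -}

module Defs where

open import Data.Nat using (ℕ; zero; suc; _<_; _⊔_)
open import Data.Nat.Properties using (_≟_)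
open import Data.List using (List; []; _∷_; foldr; filter)
open import Data.Maybe using (Maybe; just; nothing)
open import Data.Bool using (if_then_else_)
open import Relation.Nullary using (¬_; does; ¬?)

open import Data.Product using (_×_)
open import Function.Bundles using (_⇔_)
open import Data.List.Membership.DecPropositional _≟_ public using (_∈_; _∉_; _∈?_)

-- Finite subsets of ℕ are represented by lists (duplicates / order irrelevant);
-- all operations below depend only on membership.

search : List ℕ → List ℕ → ℕ → Maybe ℕ
search T P zero = nothing
search T P (suc k) =
  if does (k ∈? T) then (if does (k ∈? P) then search T P k else just k)
  else search T P k

step : List ℕ → List ℕ → ℕ → List ℕ → List ℕ
step T S s P with does (s ∈? S)
... | Data.Bool.false = P
... | Data.Bool.true with search T P s
...   | nothing = P
...   | just t = t ∷ P

go : List ℕ → List ℕ → ℕ → List ℕ → List ℕ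
go T S zero P = P
go T S (suc k) P = go T S k (step T S k P)

maxL : List ℕ → ℕ
maxL = foldr _⊔_ 0

-- T ◁ S : go through s ∈ S from largest to smallest; each s picks the largest
-- not-yet-picked t ∈ T with t < s (if any); result = set of picked elements.
_◁_ : List ℕ → List ℕ → List ℕ
T ◁ S = go T S (suc (maxL S)) []

remove : ℕ → List ℕ → List ℕ
remove x T = filter (λ y → ¬? (y ≟ x)) T

_≐_ : List ℕ → List ℕ → Set
A ≐ B = ∀ y → (y ∈ A) ⇔ (y ∈ B)

IsMaxBelowUnpicked : List ℕ → List ℕ → ℕ → ℕ → Set
IsMaxBelowUnpicked T S x x' =
  (x' ∈ T × x' < x × x' ∉ (T ◁ S)) ×
  (∀ t → t ∈ T → t < x → t ∉ (T ◁ S) → t Data.Nat.≤ x')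

-- Run the greedy matchings for T and T∖{x} side by side.  Until some s picks x,
-- both runs make the same choices.  From then on the partial results differ in
-- one place: the run for T∖{x} lacks x but holds instead h, the largest element
-- below x not yet picked by the run for T (if there is one).  When the run for T
-- picks h, the same s in the other run can only take the next unpicked element
-- below h, which becomes the new h; every other pick is shared.  At the end h is
-- the x′ of the statement.
module Submission where

open import Defs
open import Data.Nat using (ℕ; zero; suc; _<_; _≤_)
open import Data.Nat.Properties
  using (_≟_; _<?_; <-cmp; <⇒≤; <⇒≢; <⇒≱; ≮⇒≥; <-≤-trans; ≤-antisym; ≤-pred; n≤1+n; n<1+n)
open import Data.List using (List; []; _∷_)
open import Data.List.Properties using (filter-accept; filter-reject)
open import Data.List.Relation.Unary.All using (All; []; _∷_; lookup)
open import Data.List.Relation.Unary.Any using (here; there)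
open import Data.List.Membership.Propositional.Properties using (∈-filter⁺; ∈-filter⁻)
open import Data.List.Relation.Binary.Permutation.Propositional
  using (_↭_; ↭-refl; ↭-sym; ↭-trans; ↭-prep; ↭-swap; ↭-reflexive)
open import Data.List.Relation.Binary.Permutation.Propositional.Properties using (∈-resp-↭; filter-↭)
open import Data.Maybe using (Maybe; just; nothing)
open import Data.Maybe.Relation.Unary.All as Maybe using (just; nothing)
open import Data.Bool using (true; false; if_then_else_)
open import Data.Product using (_×_; _,_; proj₁; proj₂; ∃-syntax)
open import Data.Empty using (⊥-elim)
open import Relation.Nullary using (¬_; does; yes; no; ¬?)
open import Relation.Binary.PropositionalEquality using (_≡_; _≢_; refl; sym; subst)
open import Relation.Binary.Definitions using (tri<; tri≈; tri>)
open import Function.Bundles using (_⇔_; mk⇔; Equivalence)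

private
  variable
    T P P′ Q S : List ℕ
    k s t u x : ℕ
    h m m′ : Maybe ℕ
    F G : ℕ → Set

data MaxBelow (F : ℕ → Set) (s : ℕ) : Maybe ℕ → Set where
  none : (∀ {k} → k < s → ¬ F k) → MaxBelow F s nothing
  some : t < s → F t → (∀ {k} → t < k → k < s → ¬ F k) → MaxBelow F s (just t)

maxBelow-unique : MaxBelow F s m → MaxBelow F s m′ → m ≡ m′
maxBelow-unique (none _)        (none _)        = refl
maxBelow-unique (none ∅)        (some t<s Ft _) = ⊥-elim (∅ t<s Ft)
maxBelow-unique (some t<s Ft _) (none ∅)        = ⊥-elim (∅ t<s Ft)
maxBelow-unique (some {t = t} t<s Ft gap) (some {t = t′} t′<s Ft′ gap′) with <-cmp t t′
... | tri< t<t′ _ _ = ⊥-elim (gap t<t′ t′<s Ft′)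
... | tri≈ _ refl _ = refl
... | tri> _ _ t′<t = ⊥-elim (gap′ t′<t t<s Ft)

maxBelow-< : MaxBelow F s (just t) → t < s
maxBelow-< (some t<s _ _) = t<s

maxBelow-all : MaxBelow F s m → Maybe.All F m
maxBelow-all (none _)      = nothing
maxBelow-all (some _ Ft _) = just Ft

maxBelow-⊆ : (∀ {k} → G k → F k) → MaxBelow F s m → Maybe.All G m → MaxBelow G s m
maxBelow-⊆ G⊆F (none ∅)         nothing   = none λ k<s Gk → ∅ k<s (G⊆F Gk)
maxBelow-⊆ G⊆F (some t<s _ gap) (just Gt) = some t<s Gt λ t<k k<s Gk → gap t<k k<s (G⊆F Gk)

maxBelow-cong : (∀ {k} → F k ⇔ G k) → MaxBelow F s m → MaxBelow G s m
maxBelow-cong F⇔G fm =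
  maxBelow-⊆ (Equivalence.from F⇔G) fm (Maybe.map (Equivalence.to F⇔G) (maxBelow-all fm))

maxBelow-restrict : u ≤ s → (∀ {k} → u ≤ k → k < s → ¬ F k) → MaxBelow F s m → MaxBelow F u m
maxBelow-restrict u≤s _ (none ∅) = none λ k<u → ∅ (<-≤-trans k<u u≤s)
maxBelow-restrict {u = u} u≤s empty (some {t = t} t<s Ft gap) with t <? u
... | yes t<u = some t<u Ft λ t<k k<u → gap t<k (<-≤-trans k<u u≤s)
... | no  t≮u = ⊥-elim (empty (≮⇒≥ t≮u) t<s Ft)

maxBelow-extend : s ≤ u → (∀ {k} → s ≤ k → k < u → ¬ F k) → MaxBelow F s m → MaxBelow F u m
maxBelow-extend {s = s} {u = u} {F = F} s≤u empty (none ∅) = none below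
  where
  below : k < u → ¬ F k
  below {k} k<u with k <? s
  ... | yes k<s = ∅ k<s
  ... | no  k≮s = empty (≮⇒≥ k≮s) k<u
maxBelow-extend {s = s} {u = u} {F = F} s≤u empty (some {t = t} t<s Ft gap) =
  some (<-≤-trans t<s s≤u) Ft above
  where
  above : t < k → k < u → ¬ F k
  above {k} t<k k<u with k <? s
  ... | yes k<s = gap t<k k<s
  ... | no  k≮s = empty (≮⇒≥ k≮s) k<u

maxBelow-suc : ¬ F s → MaxBelow F s m → MaxBelow F (suc s) m
maxBelow-suc {F = F} {s = s} ¬Fs =
  maxBelow-extend (n≤1+n s) λ s≤k k<1+s → subst (λ j → ¬ F j) (≤-antisym s≤k (≤-pred k<1+s)) ¬Fs

Unpicked : List ℕ → List ℕ → ℕ → Set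
Unpicked T P k = k ∈ T × k ∉ P

search-maxBelow : ∀ T P s → MaxBelow (Unpicked T P) s (search T P s)
search-maxBelow T P zero = none λ ()
search-maxBelow T P (suc k) with k ∈? T | k ∈? P
... | yes k∈T | no k∉P  = some (n<1+n k) (k∈T , k∉P) λ k<j j<1+k _ → <⇒≱ k<j (≤-pred j<1+k)
... | yes _   | yes k∈P = maxBelow-suc (λ (_ , k∉P) → k∉P k∈P) (search-maxBelow T P k)
... | no k∉T  | _       = maxBelow-suc (λ (k∈T , _) → k∉T k∈T) (search-maxBelow T P k)

infixr 5 _∷?_
_∷?_ : Maybe ℕ → List ℕ → List ℕ
nothing ∷? P = P
just t  ∷? P = t ∷ P

step-∷? : ∀ T S s P → step T S s P ≡ (if does (s ∈? S) then search T P s ∷? P else P)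
step-∷? T S s P with does (s ∈? S)
... | false = refl
... | true with search T P s
...   | nothing = refl
...   | just t  = refl

∈-∷?⁺ : ∀ m → k ∈ P → k ∈ m ∷? P
∈-∷?⁺ nothing  k∈P = k∈P
∈-∷?⁺ (just _) k∈P = there k∈P

∷?-swap : ∀ h → h ∷? t ∷ P ↭ t ∷ h ∷? P
∷?-swap nothing  = ↭-refl
∷?-swap (just d) = ↭-swap d _ ↭-refl

∷?-fresh : t ∈ h ∷? P → t ∉ P → h ≡ just t
∷?-fresh {h = nothing} t∈P       t∉P = ⊥-elim (t∉P t∈P)
∷?-fresh {h = just d}  (here refl) _  = refl
∷?-fresh {h = just d}  (there t∈P) t∉P = ⊥-elim (t∉P t∈P)

unpicked-∷?⁻ : Unpicked T (h ∷? P) k → Unpicked T P k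
unpicked-∷?⁻ {h = nothing} unp          = unp
unpicked-∷?⁻ {h = just d}  (k∈T , k∉dP) = k∈T , λ k∈P → k∉dP (there k∈P)

∈-remove⁺ : k ∈ P → k ≢ x → k ∈ remove x P
∈-remove⁺ {x = x} = ∈-filter⁺ (λ y → ¬? (y ≟ x))

∈-remove⁻ : k ∈ remove x P → k ∈ P × k ≢ x
∈-remove⁻ {x = x} {P = P} = ∈-filter⁻ (λ y → ¬? (y ≟ x)) {xs = P}

remove-∷ : t ≢ x → remove x (t ∷ P) ≡ t ∷ remove x P
remove-∷ {x = x} = filter-accept (λ y → ¬? (y ≟ x))

∷?-remove : Maybe.All (_≢ x) m → P′ ↭ remove x Q → m ∷? P′ ↭ remove x (m ∷? Q)
∷?-remove nothing       p = p
∷?-remove (just t≢x)   p = ↭-trans (↭-prep _ p) (↭-reflexive (sym (remove-∷ t≢x)))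

unpicked-remove : x ∈ Q → P′ ↭ remove x Q → Unpicked (remove x T) P′ k ⇔ Unpicked T Q k
unpicked-remove {x = x} {Q = Q} {P′ = P′} {T = T} {k = k} x∈Q p = mk⇔ to from
  where
  to : Unpicked (remove x T) P′ k → Unpicked T Q k
  to (k∈T∖x , k∉P′) with ∈-remove⁻ k∈T∖x
  ... | k∈T , k≢x = k∈T , λ k∈Q → k∉P′ (∈-resp-↭ (↭-sym p) (∈-remove⁺ k∈Q k≢x))
  from : Unpicked T Q k → Unpicked (remove x T) P′ k
  from (k∈T , k∉Q) =
    ∈-remove⁺ k∈T (λ { refl → k∉Q x∈Q }) , λ k∈P′ → k∉Q (proj₁ (∈-remove⁻ (∈-resp-↭ p k∈P′)))

↭⇒≐ : P ↭ Q → P ≐ Q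
↭⇒≐ p y = mk⇔ (∈-resp-↭ p) (∈-resp-↭ (↭-sym p))

-- Before x is picked h is x itself, so both phases share one invariant.
record Coupled (T : List ℕ) (x : ℕ) (h : Maybe ℕ) (P P′ : List ℕ) : Set where
  constructor coupled
  field
    h-largest : MaxBelow (Unpicked T P) (suc x) h
    x∈ : x ∈ h ∷? P
    ↭-remove : P′ ↭ remove x (h ∷? P)

coupled-unpicked : Coupled T x h P P′ → Unpicked (remove x T) P′ k ⇔ Unpicked T (h ∷? P) k
coupled-unpicked (coupled _ x∈ p) = unpicked-remove x∈ p

coupled-⊆ : Coupled T x h P P′ → Unpicked (remove x T) P′ k → Unpicked T P k
coupled-⊆ {h = h} c unp = unpicked-∷?⁻ {h = h} (Equivalence.to (coupled-unpicked c) unp)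

coupled-≐ : Coupled T x h P P′ → MaxBelow (Unpicked T P) (suc x) m → P′ ≐ remove x (m ∷? P)
coupled-≐ (coupled h-largest _ p) fm rewrite maxBelow-unique fm h-largest = ↭⇒≐ p

coupled-init : x ∈ T → Coupled T x (just x) [] []
coupled-init {x = x} x∈T = coupled
  (some (n<1+n x) (x∈T , λ ()) λ x<k k<1+x _ → <⇒≱ x<k (≤-pred k<1+x))
  (here refl)
  (↭-reflexive (sym (filter-reject (λ y → ¬? (y ≟ x)) λ x≢x → x≢x refl)))

coupled-keep : Coupled T x h P P′ → Unpicked T (h ∷? P) t → Coupled T x h (t ∷ P) (t ∷ P′)
coupled-keep {T = T} {x = x} {h = h} {P = P} {t = t} (coupled h-largest x∈ p) (_ , t∉hP) = coupled
  (maxBelow-⊆ (unpicked-∷?⁻ {h = just t}) h-largest (still-unpicked h-largest))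
  (∈-resp-↭ (↭-sym (∷?-swap h)) (there x∈))
  (↭-trans (∷?-remove (just t≢x) p) (filter-↭ _ (↭-sym (∷?-swap h))))
  where
  t≢x : t ≢ x
  t≢x refl = t∉hP x∈
  still-unpicked : MaxBelow (Unpicked T P) s h → Maybe.All (Unpicked T (t ∷ P)) h
  still-unpicked (none _) = nothing
  still-unpicked (some _ (d∈T , d∉P) _) =
    just (d∈T , λ { (here refl) → t∉hP (here refl) ; (there d∈P) → d∉P d∈P })

maxBelow-taken : MaxBelow (Unpicked T P) s (just t) → t ≤ k → k < s → ¬ Unpicked T (t ∷ P) k
maxBelow-taken {k = k} (some {t = t} _ _ gap) t≤k k<s (k∈T , k∉tP) with <-cmp t k
... | tri< t<k _ _ = gap t<k k<s (unpicked-∷?⁻ {h = just t} (k∈T , k∉tP))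
... | tri≈ _ refl _ = k∉tP (here refl)
... | tri> _ _ k<t = <⇒≱ k<t t≤k

coupled-displace : Coupled T x (just t) P P′ → MaxBelow (Unpicked T P) s (just t) →
  MaxBelow (Unpicked (remove x T) P′) s m′ → Coupled T x m′ (t ∷ P) (m′ ∷? P′)
coupled-displace {T = T} {m′ = m′} c@(coupled h-largest x∈ p) fm fm′ = coupled
  (maxBelow-extend (<⇒≤ (maxBelow-< h-largest)) (maxBelow-taken h-largest)
    (maxBelow-restrict (<⇒≤ (maxBelow-< fm)) (maxBelow-taken fm)
      (maxBelow-cong (coupled-unpicked c) fm′)))
  (∈-∷?⁺ m′ x∈)
  (∷?-remove (Maybe.map (λ (k∈T∖x , _) → proj₂ (∈-remove⁻ {P = T} k∈T∖x)) (maxBelow-all fm′)) p)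

coupled-pick : Coupled T x h P P′ → MaxBelow (Unpicked T P) s m →
  MaxBelow (Unpicked (remove x T) P′) s m′ → ∃[ h′ ] Coupled T x h′ (m ∷? P) (m′ ∷? P′)
coupled-pick {h = h} c fm@(none _) fm′ with maxBelow-unique fm′ (maxBelow-⊆ (coupled-⊆ c) fm nothing)
... | refl = h , c
coupled-pick {h = h} {P = P} c fm@(some {t = t} _ (t∈T , t∉P) _) fm′ with t ∈? h ∷? P
... | no t∉hP with maxBelow-unique fm′
      (maxBelow-⊆ (coupled-⊆ c) fm (just (Equivalence.from (coupled-unpicked c) (t∈T , t∉hP))))
...   | refl = h , coupled-keep c (t∈T , t∉hP)
coupled-pick {h = h} {P = P} c fm@(some {t = t} _ (t∈T , t∉P) _) fm′ | yes t∈hP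
  with ∷?-fresh {h = h} t∈hP t∉P
... | refl = _ , coupled-displace c fm fm′

coupled-step : ∀ s → Coupled T x h P P′ →
  ∃[ h′ ] Coupled T x h′ (step T S s P) (step (remove x T) S s P′)
coupled-step {T = T} {x = x} {P = P} {P′ = P′} {S = S} s c
  rewrite step-∷? T S s P | step-∷? (remove x T) S s P′ with does (s ∈? S)
... | false = _ , c
... | true  = coupled-pick c (search-maxBelow T P s) (search-maxBelow (remove x T) P′ s)

coupled-go : ∀ k → Coupled T x h P P′ →
  ∃[ h′ ] Coupled T x h′ (go T S k P) (go (remove x T) S k P′)
coupled-go zero    c = _ , c
coupled-go {S = S} (suc k) c = coupled-go k (proj₂ (coupled-step {S = S} k c))

step-⊆ : ∀ s → All (_∈ T) P → All (_∈ T) (step T S s P)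
step-⊆ {T = T} {P = P} {S = S} s P⊆T rewrite step-∷? T S s P with does (s ∈? S)
... | false = P⊆T
... | true  with search T P s | search-maxBelow T P s
...   | nothing | _ = P⊆T
...   | just t  | some _ (t∈T , _) _ = t∈T ∷ P⊆T

go-⊆ : ∀ k → All (_∈ T) P → All (_∈ T) (go T S k P)
go-⊆ zero    P⊆T = P⊆T
go-⊆ {S = S} (suc k) P⊆T = go-⊆ k (step-⊆ {S = S} k P⊆T)

◁-⊆ : k ∈ T ◁ S → k ∈ T
◁-⊆ {S = S} = lookup (go-⊆ (suc (maxL S)) [])

◁-coupled : x ∈ T → ∃[ h ] Coupled T x h (T ◁ S) (remove x T ◁ S)
◁-coupled {S = S} x∈T = coupled-go (suc (maxL S)) (coupled-init x∈T)

lemma4p5 : (T S : List ℕ) → All (0 <_) T → All (0 <_) S →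
    (x : ℕ) → x ∈ (T ◁ S) →
    ((∀ t → t ∈ T → t < x → t ∈ (T ◁ S)) →
       (remove x T ◁ S) ≐ remove x (T ◁ S)) ×
    (∀ x' → IsMaxBelowUnpicked T S x x' →
       (remove x T ◁ S) ≐ (x' ∷ remove x (T ◁ S)))
lemma4p5 T S _ _ x x∈R with ◁-coupled {S = S} (◁-⊆ {S = S} x∈R)
... | _ , c = all-picked , max-unpicked
  where
  x-picked : ¬ Unpicked T (T ◁ S) x
  x-picked (_ , x∉R) = x∉R x∈R
  all-picked : (∀ t → t ∈ T → t < x → t ∈ (T ◁ S)) → (remove x T ◁ S) ≐ remove x (T ◁ S)
  all-picked picked = coupled-≐ c (maxBelow-suc x-picked
    (none λ k<x (k∈T , k∉R) → k∉R (picked _ k∈T k<x)))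
  max-unpicked : ∀ x′ → IsMaxBelowUnpicked T S x x′ → (remove x T ◁ S) ≐ (x′ ∷ remove x (T ◁ S))
  max-unpicked x′ ((x′∈T , x′<x , x′∉R) , maximal) =
    subst (_ ≐_) (remove-∷ (<⇒≢ x′<x)) (coupled-≐ c (maxBelow-suc x-picked
      (some x′<x (x′∈T , x′∉R) λ x′<k k<x (k∈T , k∉R) → <⇒≱ x′<k (maximal _ k∈T k<x k∉R))))
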